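{- Suppose $0<1/n\ll\eta\ll1/C\ll1/2-\alpha\le1/2$ (so in particular $0\le\alpha<1/2$). Let $G$ be an $\eta$-extremal graph on $n$ vertices with $\delta:=\delta(G)=(1/2+\alpha)n$, and let $A,B\subset V(G)$ be disjoint sets satisfying (E1)–(E4) for $G$. Then there is a spanning subgraph $G_1$ of $G$ such that: (i) $A$ and $B$ satisfy (E1)–(E4) for the graph $G_1$ (in particular $G_1$ is $\eta$-extremal); (ii) $\delta(G_1)=\delta$; (iii) $e_{G_1}(A)<C\eta|A|^2$.
   Context: Hierarchy convention: a statement "holds whenever $0<1/n\ll a\ll b\ll\dots$" means there are non-decreasing functions such that it holds whenever each parameter is at most the corresponding function of the parameter to its right. $x_+:=\max\{x,0\}$. Definition: Let $\eta>0$, $-1/2\le\alpha\le1/2$, and let $G$ be a graph on $n$ vertices with $\delta(G)=(1/2+\alpha)n$. $G$ is $\eta$-extremal if there exist disjoint $A,B\subset V(G)$ with (E1) $|A|=(1/2-\sqrt{\alpha_+/2}\pm\eta)n$; (E2) $|B|=(1/2+\sqrt{\alpha_+/2}\pm\eta)n$; (E3) $e(A,B)>(1-\eta)|A||B|$; (E4) $e(B)<(\alpha_++\sqrt{\alpha_+/2}+\eta)n|B|/2$. Here $a=x\pm\epsilon$ means $x-\epsilon\le a\le x+\epsilon$; $e(A,B)$ counts edges between $A$ and $B$, $e(X)$ (or $e_{G_1}(X)$) counts edges inside $X$.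
   Formalization: The parameters η and C are rational, and the non-decreasing functions of the hierarchy convention are taken from ℚ to ℚ. -}

module Defs where

open import Data.Bool using (Bool; true; false; _∧_; if_then_else_)
open import Data.Nat as ℕ using (ℕ; _<ᵇ_)
open import Data.Fin using (Fin; toℕ)
open import Data.Fin.Subset using (Subset; ∣_∣)
open import Data.Vec using (lookup)
open import Data.List using (List; map; allFin)
open import Data.Nat.ListAction using (sum)
open import Data.Integer using (+_)
open import Data.Rational using (ℚ; _/_; _+_; _-_; _*_; _≤_; _<_; _⊔_; 0ℚ; 1ℚ; ½)
open import Data.Product using (_×_; ∃)
open import Data.Sum using (_⊎_)
open import Relation.Binary.PropositionalEquality using (_≡_)
open import Relation.Nullary using (¬_)

record Graph (n : ℕ) : Set where
  field
    adj    : Fin n → Fin n → Bool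
    sym    : ∀ i j → adj i j ≡ adj j i
    irrefl : ∀ i → adj i i ≡ false
open Graph public

[_] : ℕ → ℚ
[ k ] = (+ k) / 1

count : ∀ {n} → (Fin n → Bool) → ℕ
count {n} P = sum (map (λ i → if P i then 1 else 0) (allFin n))

deg : ∀ {n} → Graph n → Fin n → ℕ
deg G v = count (adj G v)

IsMinDeg : ∀ {n} → Graph n → ℕ → Set
IsMinDeg {n} G d = (∀ v → d ℕ.≤ deg G v) × ∃ (λ v → deg G v ≡ d)

SpanningSubgraph : ∀ {n} → Graph n → Graph n → Set
SpanningSubgraph {n} G₁ G = ∀ i j → adj G₁ i j ≡ true → adj G i j ≡ true

Disjoint : ∀ {n} → Subset n → Subset n → Set
Disjoint {n} A B = ∀ (i : Fin n) → ¬ (lookup A i ≡ true × lookup B i ≡ true)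

eBetween : ∀ {n} → Graph n → Subset n → Subset n → ℕ
eBetween {n} G A B =
  sum (map (λ i → count (λ j → lookup A i ∧ lookup B j ∧ adj G i j)) (allFin n))

eIn : ∀ {n} → Graph n → Subset n → ℕ
eIn {n} G X =
  sum (map (λ i → count (λ j → (toℕ i <ᵇ toℕ j) ∧ lookup X i ∧ lookup X j ∧ adj G i j)) (allFin n))

_₊ : ℚ → ℚ
x ₊ = x ⊔ 0ℚ

-- comparisons with the real number √q (for q ≥ 0), stated without reals:
-- x ≤ √q,  √q ≤ x,  x < √q
_≤√_ : ℚ → ℚ → Set
x ≤√ q = (x ≤ 0ℚ) ⊎ (x * x ≤ q)

_√≤_ : ℚ → ℚ → Set
q √≤ x = (0ℚ ≤ x) × (q ≤ x * x)

_<√_ : ℚ → ℚ → Set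
x <√ q = (x < 0ℚ) ⊎ (x * x < q)

-- (E1)–(E4) for G, A, B with parameters η, α.  Writing s = √(α₊/2), the
-- conditions with s·n or s·n|B| on one side are expressed via
-- s·N = √(α₊/2 · N²) for N ≥ 0.
module _ {n : ℕ} (η α : ℚ) (G : Graph n) (A B : Subset n) where
  private
    nq = [ n ]
    a  = [ ∣ A ∣ ]
    b  = [ ∣ B ∣ ]
    q  = ½ * (α ₊)
  -- (E1) (1/2 - s - η) n ≤ |A| ≤ (1/2 - s + η) n
  E1 : Set
  E1 = (((½ - η) * nq - a) ≤√ (q * (nq * nq)))
     × ((q * (nq * nq)) √≤ ((½ + η) * nq - a))
  -- (E2) (1/2 + s - η) n ≤ |B| ≤ (1/2 + s + η) n
  E2 : Set
  E2 = ((q * (nq * nq)) √≤ (b - (½ - η) * nq))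
     × ((b - (½ + η) * nq) ≤√ (q * (nq * nq)))
  E3 : Set
  E3 = (1ℚ - η) * a * b < [ eBetween G A B ]
  -- (E4) e(B) < (α₊ + s + η) n |B| / 2
  E4 : Set
  E4 = ([ 2 ℕ.* eIn G B ] - ((α ₊) + η) * nq * b) <√ (q * ((nq * b) * (nq * b)))

  Extremal-E1-E4 : Set
  Extremal-E1-E4 = Disjoint A B × E1 × E2 × E3 × E4

-- Delete, one at a time, edges inside A both of whose ends have degree above δ. Edges meeting
-- V ∖ A are never touched, so e(A,B) and e(B), hence (E1)–(E4), survive, and a vertex of degree δ
-- keeps its degree, so δ(G₁) = δ. When no such edge is left, every edge inside A has an end v of
-- degree δ, and v has at most δ − deg_B(v) neighbours in A. Charging each edge of A to such an end
-- gives e(A) + 2e(A,B) ≤ 2(δ ⊔ |B|)|A|. Now (E2) gives δ ≤ |B| + ηn and (E3) gives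
-- e(A,B) > (1 − η)|A||B|, so e(A) < 4ηn|A|; and (E1) with η ≤ (1/2 − α)/64 gives 8|A| ≥ (1/2 − α)n,
-- so 8n ≤ C|A| once 1/C ≤ (1/2 − α)/64, and e(A) < Cη|A|².
-- The hierarchy is thus realised by f₁ x = 1, f₂ x = x and f₃ x = x/64.
module Submission where

open import Defs

module Combinatorial where
  import Algebra.Properties.Semiring.Sum as ∑
  open import Data.Bool using (Bool; true; false; _∧_; _∨_; not; if_then_else_)
  open import Data.Bool.Properties using (∧-comm; ∨-comm; ∧-identityʳ; ∧-zeroʳ) renaming (_≟_ to _≟ᵇ_)
  open import Data.Empty using (⊥-elim)
  open import Data.Fin using (Fin; toℕ) renaming (zero to fzero; suc to fsuc)
  open import Data.Fin.Properties as Fin using (_≟_; any?)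
  open import Data.Fin.Subset using (Subset; ∣_∣; outside; inside)
  open import Data.List as List using (allFin)
  open import Data.List.Properties using (map-tabulate; map-cong)
  open import Data.Nat as ℕ using (ℕ; zero; suc; _+_; _*_; _⊔_; _≤_; _<_; z≤n; s≤s)
  open import Data.Nat.ListAction using () renaming (sum to listSum)
  open import Data.Nat.Properties hiding (_≟_)
  open import Data.Product using (_×_; _,_; Σ)
  open import Data.Sum as Sum using (_⊎_; inj₁; inj₂)
  open import Data.Vec using (lookup; []; _∷_)
  open import Function using (_∘_; id)
  open import Relation.Binary.PropositionalEquality as ≡ hiding (sym)
  open import Relation.Nullary using (¬_; Dec; yes; no; does)
  open import Relation.Nullary.Decidable using (dec-true; dec-false; _×-dec_)

  open ∑ +-*-semiring using (sum-syntax; sum-cong-≗; ∑-distrib-+; ∑-comm; sum-replicate-zero; *-distribˡ-sum)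

  𝟙 : Bool → ℕ
  𝟙 b = if b then 1 else 0

  𝟙≤1 : ∀ b → 𝟙 b ≤ 1
  𝟙≤1 true  = ≤-refl
  𝟙≤1 false = z≤n

  𝟙-mono : ∀ {x y} → (x ≡ true → y ≡ true) → 𝟙 x ≤ 𝟙 y
  𝟙-mono {false} h = z≤n
  𝟙-mono {true}  h rewrite h refl = ≤-refl

  ∧-trueˡ : ∀ x {y} → x ∧ y ≡ true → x ≡ true
  ∧-trueˡ true _ = refl

  ∧-trueʳ : ∀ x {y} → x ∧ y ≡ true → y ≡ true
  ∧-trueʳ true y≡true = y≡true

  ∑-mono-≤ : ∀ {n} {f g : Fin n → ℕ} → (∀ i → f i ≤ g i) → ∑[ i < n ] f i ≤ ∑[ i < n ] g i
  ∑-mono-≤ {zero}  f≤g = z≤n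
  ∑-mono-≤ {suc n} f≤g = +-mono-≤ (f≤g fzero) (∑-mono-≤ (f≤g ∘ fsuc))

  ∑-mono-< : ∀ {n} {f g : Fin n → ℕ} → (∀ i → f i ≤ g i) → ∀ k → f k < g k →
             ∑[ i < n ] f i < ∑[ i < n ] g i
  ∑-mono-< {suc n} f≤g fzero    fk<gk = +-mono-<-≤ fk<gk (∑-mono-≤ (f≤g ∘ fsuc))
  ∑-mono-< {suc n} f≤g (fsuc k) fk<gk = +-mono-≤-< (f≤g fzero) (∑-mono-< (f≤g ∘ fsuc) k fk<gk)

  ∑-≤-suc : ∀ {n} {f g : Fin n → ℕ} k → (∀ i → i ≢ k → g i ≤ f i) → g k ≤ suc (f k) →
            ∑[ i < n ] g i ≤ suc (∑[ i < n ] f i)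
  ∑-≤-suc {suc n}         fzero    g≤f gk≤ = +-mono-≤ gk≤ (∑-mono-≤ λ i → g≤f (fsuc i) λ ())
  ∑-≤-suc {suc n} {f} {g} (fsuc k) g≤f gk≤ = begin
    g fzero + ∑[ i < n ] g (fsuc i)        ≤⟨ +-mono-≤ (g≤f fzero λ ()) (∑-≤-suc k g≤f′ gk≤) ⟩
    f fzero + suc (∑[ i < n ] f (fsuc i))  ≡⟨ +-suc (f fzero) _ ⟩
    suc (∑[ i < suc n ] f i)               ∎
    where
    open ≤-Reasoning
    g≤f′ : ∀ i → i ≢ k → g (fsuc i) ≤ f (fsuc i)
    g≤f′ i i≢k = g≤f (fsuc i) (i≢k ∘ Fin.suc-injective)

  listSum-tabulate : ∀ {n} (f : Fin n → ℕ) → listSum (List.tabulate f) ≡ ∑[ i < n ] f i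
  listSum-tabulate {zero}  f = refl
  listSum-tabulate {suc n} f = cong (f fzero +_) (listSum-tabulate (f ∘ fsuc))

  listSum-allFin : ∀ {n} (f : Fin n → ℕ) → listSum (List.map f (allFin n)) ≡ ∑[ i < n ] f i
  listSum-allFin f = trans (cong listSum (map-tabulate id f)) (listSum-tabulate f)

  count≡∑ : ∀ {n} (P : Fin n → Bool) → count P ≡ ∑[ i < n ] 𝟙 (P i)
  count≡∑ P = listSum-allFin (𝟙 ∘ P)

  ∣p∣≡count : ∀ {n} (p : Subset n) → ∣ p ∣ ≡ count (lookup p)
  ∣p∣≡count p = trans (∣p∣≡∑ p) (≡.sym (count≡∑ (lookup p)))
    where
    ∣p∣≡∑ : ∀ {n} (p : Subset n) → ∣ p ∣ ≡ ∑[ i < n ] 𝟙 (lookup p i)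
    ∣p∣≡∑ []            = refl
    ∣p∣≡∑ (inside  ∷ p) = cong suc (∣p∣≡∑ p)
    ∣p∣≡∑ (outside ∷ p) = ∣p∣≡∑ p

  module _ {n : ℕ} where

    count-cong : {P Q : Fin n → Bool} → (∀ i → P i ≡ Q i) → count P ≡ count Q
    count-cong {P} {Q} P≗Q = begin
      count P              ≡⟨ count≡∑ P ⟩
      ∑[ i < n ] 𝟙 (P i)   ≡⟨ sum-cong-≗ (cong 𝟙 ∘ P≗Q) ⟩
      ∑[ i < n ] 𝟙 (Q i)   ≡⟨ count≡∑ Q ⟨
      count Q              ∎
      where open ≡-Reasoning

    count-mono : {P Q : Fin n → Bool} → (∀ i → P i ≡ true → Q i ≡ true) → count P ≤ count Q
    count-mono {P} {Q} P⇒Q = subst₂ _≤_ (≡.sym (count≡∑ P)) (≡.sym (count≡∑ Q)) (∑-mono-≤ (𝟙-mono ∘ P⇒Q))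

    count-mono-< : {P Q : Fin n → Bool} → (∀ i → P i ≡ true → Q i ≡ true) →
                   ∀ k → P k ≡ false → Q k ≡ true → count P < count Q
    count-mono-< {P} {Q} P⇒Q k ¬Pk Qk = subst₂ _<_ (≡.sym (count≡∑ P)) (≡.sym (count≡∑ Q))
      (∑-mono-< (𝟙-mono ∘ P⇒Q) k (subst₂ (λ x y → 𝟙 x < 𝟙 y) (≡.sym ¬Pk) (≡.sym Qk) ≤-refl))

    count-≤-suc : {P Q : Fin n → Bool} → ∀ k → (∀ i → i ≢ k → Q i ≡ P i) → count Q ≤ suc (count P)
    count-≤-suc {P} {Q} k Q≗P = subst₂ (λ x y → x ≤ suc y) (≡.sym (count≡∑ Q)) (≡.sym (count≡∑ P))
      (∑-≤-suc k (λ i i≢k → ≤-reflexive (cong 𝟙 (Q≗P i i≢k))) (≤-trans (𝟙≤1 (Q k)) (s≤s z≤n)))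

    count-∧ˡ : ∀ x (P : Fin n → Bool) → count (λ i → x ∧ P i) ≡ 𝟙 x * count P
    count-∧ˡ true  P = ≡.sym (*-identityˡ (count P))
    count-∧ˡ false P = trans (count≡∑ {n} (λ _ → false)) (sum-replicate-zero n)

  -- Deleting an edge
  module _ {n : ℕ} where

    isPair : (u v i j : Fin n) → Bool
    isPair u v i j = (does (i ≟ u) ∧ does (j ≟ v)) ∨ (does (i ≟ v) ∧ does (j ≟ u))

    isPair-sym : ∀ u v i j → isPair u v i j ≡ isPair u v j i
    isPair-sym u v i j = trans (∨-comm (does (i ≟ u) ∧ does (j ≟ v)) _)
      (cong₂ _∨_ (∧-comm (does (i ≟ v)) (does (j ≟ u))) (∧-comm (does (i ≟ u)) (does (j ≟ v))))

    isPair-diag : ∀ u v → isPair u v u v ≡ true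
    isPair-diag u v rewrite dec-true (u ≟ u) refl | dec-true (v ≟ v) refl = refl

    isPair-false : ∀ {u v} i j → i ≢ u ⊎ j ≢ v → i ≢ v ⊎ j ≢ u → isPair u v i j ≡ false
    isPair-false i j uv≠ vu≠ = cong₂ _∨_ (∧-false uv≠) (∧-false vu≠)
      where
      ∧-false : ∀ {x y z w : Fin n} → x ≢ z ⊎ y ≢ w → does (x ≟ z) ∧ does (y ≟ w) ≡ false
      ∧-false {x} {y} {z} {w} (inj₁ x≢z) rewrite dec-false (x ≟ z) x≢z = refl
      ∧-false {x} {y} {z} {w} (inj₂ y≢w) rewrite dec-false (y ≟ w) y≢w = ∧-zeroʳ (does (x ≟ z))

    deleteEdge : Graph n → Fin n → Fin n → Graph n
    deleteEdge H u v = record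
      { adj    = λ i j → adj H i j ∧ not (isPair u v i j)
      ; sym    = λ i j → cong₂ _∧_ (Graph.sym H i j) (cong not (isPair-sym u v i j))
      ; irrefl = λ i → cong (_∧ not (isPair u v i i)) (Graph.irrefl H i)
      }

    deleteEdge-⊆ : ∀ H u v → SpanningSubgraph (deleteEdge H u v) H
    deleteEdge-⊆ H u v i j = ∧-trueˡ (adj H i j)

    deleteEdge-away : ∀ H {u v} i j → isPair u v i j ≡ false → adj (deleteEdge H u v) i j ≡ adj H i j
    deleteEdge-away H i j e≡false rewrite e≡false = ∧-identityʳ (adj H i j)

    deg-deleteEdge-≤ : ∀ H u v i → deg (deleteEdge H u v) i ≤ deg H i
    deg-deleteEdge-≤ H u v i =
      count-mono {P = adj (deleteEdge H u v) i} {Q = adj H i} (deleteEdge-⊆ H u v i)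

    deg-deleteEdge-away : ∀ H {u v i} → i ≢ u → i ≢ v → deg (deleteEdge H u v) i ≡ deg H i
    deg-deleteEdge-away H {u} {v} {i} i≢u i≢v =
      count-cong {P = adj (deleteEdge H u v) i} {Q = adj H i} λ j →
        deleteEdge-away H i j (isPair-false i j (inj₁ i≢u) (inj₁ i≢v))

    deg-deleteEdge-endˡ : ∀ H {u v} → u ≢ v → deg H u ≤ suc (deg (deleteEdge H u v) u)
    deg-deleteEdge-endˡ H {u} {v} u≢v =
      count-≤-suc {P = adj (deleteEdge H u v) u} {Q = adj H u} v λ j j≢v →
        ≡.sym (deleteEdge-away H u j (isPair-false u j (inj₂ j≢v) (inj₁ u≢v)))

    deg-deleteEdge-endʳ : ∀ H {u v} → u ≢ v → deg H v ≤ suc (deg (deleteEdge H u v) v)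
    deg-deleteEdge-endʳ H {u} {v} u≢v =
      count-≤-suc {P = adj (deleteEdge H u v) v} {Q = adj H v} u λ j j≢u →
        ≡.sym (deleteEdge-away H v j (isPair-false v j (inj₁ (u≢v ∘ ≡.sym)) (inj₂ j≢u)))

    deg-deleteEdge-< : ∀ H {u v} → adj H u v ≡ true → deg (deleteEdge H u v) u < deg H u
    deg-deleteEdge-< H {u} {v} uv∈H =
      count-mono-< {P = adj (deleteEdge H u v) u} {Q = adj H u} (deleteEdge-⊆ H u v u) v uv∉ uv∈H
      where
      uv∉ : adj (deleteEdge H u v) u v ≡ false
      uv∉ rewrite uv∈H | isPair-diag u v = refl

    AgreeOutside : Subset n → Graph n → Graph n → Set
    AgreeOutside A H G = ∀ i j → lookup A i ≡ false ⊎ lookup A j ≡ false → adj H i j ≡ adj G i j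

    Saturated : Graph n → Subset n → ℕ → Set
    Saturated H A δ = ∀ i j → lookup A i ≡ true → lookup A j ≡ true → adj H i j ≡ true →
                      deg H i ≡ δ ⊎ deg H j ≡ δ

    degreeSum : Graph n → ℕ
    degreeSum H = ∑[ v < n ] deg H v

    degreeSum-deleteEdge-< : ∀ H {u v} → adj H u v ≡ true → degreeSum (deleteEdge H u v) < degreeSum H
    degreeSum-deleteEdge-< H {u} {v} uv∈H = ∑-mono-< (deg-deleteEdge-≤ H u v) u (deg-deleteEdge-< H uv∈H)

  -- Pruning edges inside A
  module Pruning {n : ℕ} (G : Graph n) (A : Subset n) (δ : ℕ) (w : Fin n) where

    record Invariant (H : Graph n) : Set where
      field
        spanning : SpanningSubgraph H G
        agrees   : AgreeOutside A H G
        minDeg   : ∀ v → δ ≤ deg H v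
        witness  : deg H w ≡ δ

    Removable : Graph n → Fin n → Fin n → Set
    Removable H u v = lookup A u ≡ true × lookup A v ≡ true × adj H u v ≡ true × δ < deg H u × δ < deg H v

    removable? : ∀ H u v → Dec (Removable H u v)
    removable? H u v = (lookup A u ≟ᵇ true) ×-dec (lookup A v ≟ᵇ true) ×-dec (adj H u v ≟ᵇ true)
                       ×-dec (δ <? deg H u) ×-dec (δ <? deg H v)

    deleteEdge-invariant : ∀ {H u v} → Invariant H → Removable H u v → Invariant (deleteEdge H u v)
    deleteEdge-invariant {H} {u} {v} I (u∈A , v∈A , uv∈H , δ<du , δ<dv) = record
      { spanning = λ i j → spanning i j ∘ deleteEdge-⊆ H u v i j
      ; agrees   = agrees′
      ; minDeg   = minDeg′
      ; witness  = trans (deg-deleteEdge-away H (w≢ δ<du) (w≢ δ<dv)) witness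
      }
      where
      open Invariant I
      u≢v : u ≢ v
      u≢v refl with trans (≡.sym uv∈H) (Graph.irrefl H u)
      ... | ()
      w≢ : ∀ {x} → δ < deg H x → w ≢ x
      w≢ δ<dx refl = <-irrefl (≡.sym witness) δ<dx
      ∉A⇒≢ : ∀ {i x} → lookup A i ≡ false → lookup A x ≡ true → i ≢ x
      ∉A⇒≢ i∉A x∈A refl with trans (≡.sym i∉A) x∈A
      ... | ()
      agrees′ : AgreeOutside A (deleteEdge H u v) G
      agrees′ i j (inj₁ i∉A) = trans
        (deleteEdge-away H i j (isPair-false i j (inj₁ (∉A⇒≢ i∉A u∈A)) (inj₁ (∉A⇒≢ i∉A v∈A))))
        (agrees i j (inj₁ i∉A))
      agrees′ i j (inj₂ j∉A) = trans
        (deleteEdge-away H i j (isPair-false i j (inj₂ (∉A⇒≢ j∉A v∈A)) (inj₂ (∉A⇒≢ j∉A u∈A))))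
        (agrees i j (inj₂ j∉A))
      minDeg′ : ∀ x → δ ≤ deg (deleteEdge H u v) x
      minDeg′ x = byCases (x ≟ u) (x ≟ v)
        where
        byCases : Dec (x ≡ u) → Dec (x ≡ v) → δ ≤ deg (deleteEdge H u v) x
        byCases (yes refl) _          = ≤-pred (≤-trans δ<du (deg-deleteEdge-endˡ H u≢v))
        byCases (no _)     (yes refl) = ≤-pred (≤-trans δ<dv (deg-deleteEdge-endʳ H u≢v))
        byCases (no x≢u)   (no x≢v)   = subst (δ ≤_) (≡.sym (deg-deleteEdge-away H x≢u x≢v)) (minDeg x)

    prune : ∀ k H → degreeSum H ≤ k → Invariant H → Σ (Graph n) λ H′ → Invariant H′ × Saturated H′ A δ
    prune k H ∑≤k I with any? (λ u → any? (λ v → removable? H u v))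
    prune zero    H ∑≤0 I | yes (u , v , r@(_ , _ , uv∈H , _)) =
      ⊥-elim (n≮0 (<-≤-trans (degreeSum-deleteEdge-< H uv∈H) ∑≤0))
    prune (suc k) H ∑≤k I | yes (u , v , r@(_ , _ , uv∈H , _)) =
      prune k (deleteEdge H u v) (≤-pred (<-≤-trans (degreeSum-deleteEdge-< H uv∈H) ∑≤k))
            (deleteEdge-invariant I r)
    prune k       H ∑≤k I | no none = H , I , saturated
      where
      open Invariant I
      saturated : Saturated H A δ
      saturated i j i∈A j∈A ij∈H with deg H i ℕ.≟ δ | deg H j ℕ.≟ δ
      ... | yes di≡δ | _        = inj₁ di≡δ
      ... | no _     | yes dj≡δ = inj₂ dj≡δ
      ... | no di≢δ  | no dj≢δ  = ⊥-elim (none (i , j , i∈A , j∈A , ij∈H ,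
                                    ≤∧≢⇒< (minDeg i) (di≢δ ∘ ≡.sym) , ≤∧≢⇒< (minDeg j) (dj≢δ ∘ ≡.sym)))

  record SaturatedSubgraph {n} (G : Graph n) (A : Subset n) (δ : ℕ) : Set where
    field
      graph     : Graph n
      spanning  : SpanningSubgraph graph G
      minDeg    : IsMinDeg graph δ
      agrees    : AgreeOutside A graph G
      saturated : Saturated graph A δ

  saturatedSubgraph : ∀ {n} (G : Graph n) (A : Subset n) {δ} → IsMinDeg G δ → SaturatedSubgraph G A δ
  saturatedSubgraph {n} G A {δ} (δ≤deg , w , dw≡δ) = conclude (prune (degreeSum G) G ≤-refl initial)
    where
    open Pruning G A δ w
    initial : Invariant G
    initial = record { spanning = λ _ _ → id ; agrees = λ _ _ _ → refl ; minDeg = δ≤deg ; witness = dw≡δ }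
    conclude : Σ (Graph n) (λ H → Invariant H × Saturated H A δ) → SaturatedSubgraph G A δ
    conclude (G₁ , I , sat) = record
      { graph = G₁ ; spanning = spanning ; minDeg = minDeg , w , witness ; agrees = agrees ; saturated = sat }
      where open Invariant I

  -- Double counting the edges inside A
  charge : ∀ x y e s t → (x ≡ true → y ≡ true → e ≡ true → s ≡ true ⊎ t ≡ true) →
           𝟙 (x ∧ y ∧ e) ≤ 𝟙 ((x ∧ s) ∧ y ∧ e) + 𝟙 ((y ∧ t) ∧ x ∧ e)
  charge true  true  true  s t h with h refl refl refl
  ... | inj₁ refl = s≤s z≤n
  ... | inj₂ refl = m≤n+m 1 (𝟙 (s ∧ true))
  charge true  true  false _ _ _ = z≤n
  charge true  false _     _ _ _ = z≤n
  charge false _     _     _ _ _ = z≤n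

  module _ {n : ℕ} (H : Graph n) where

    degIn : Subset n → Fin n → ℕ
    degIn X i = count (λ j → lookup X j ∧ adj H i j)

    degIn≤∣X∣ : ∀ X i → degIn X i ≤ ∣ X ∣
    degIn≤∣X∣ X i = subst (degIn X i ≤_) (≡.sym (∣p∣≡count X))
      (count-mono {P = λ j → lookup X j ∧ adj H i j} {Q = lookup X} (λ j → ∧-trueˡ (lookup X j)))

    degIn-disjoint : ∀ {A B} → Disjoint A B → ∀ i → degIn A i + degIn B i ≤ deg H i
    degIn-disjoint {A} {B} A∩B≡∅ i = begin
      degIn A i + degIn B i
        ≡⟨ cong₂ _+_ (count≡∑ (λ j → lookup A j ∧ adj H i j)) (count≡∑ (λ j → lookup B j ∧ adj H i j)) ⟩
      ∑[ j < n ] 𝟙 (lookup A j ∧ adj H i j) + ∑[ j < n ] 𝟙 (lookup B j ∧ adj H i j)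
        ≡⟨ ∑-distrib-+ (λ j → 𝟙 (lookup A j ∧ adj H i j)) (λ j → 𝟙 (lookup B j ∧ adj H i j)) ⟨
      ∑[ j < n ] (𝟙 (lookup A j ∧ adj H i j) + 𝟙 (lookup B j ∧ adj H i j))
        ≤⟨ ∑-mono-≤ (λ j → split (lookup A j) (lookup B j) (adj H i j) (A∩B≡∅ j)) ⟩
      ∑[ j < n ] 𝟙 (adj H i j)
        ≡⟨ count≡∑ (adj H i) ⟨
      deg H i ∎
      where
      open ≤-Reasoning
      split : ∀ a b e → ¬ (a ≡ true × b ≡ true) → 𝟙 (a ∧ e) + 𝟙 (b ∧ e) ≤ 𝟙 e
      split true  true  e  a∩b = ⊥-elim (a∩b (refl , refl))
      split true  false e  _   = ≤-reflexive (+-identityʳ (𝟙 e))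
      split false true  e  _   = ≤-refl
      split false false e  _   = z≤n

    eBetween≡∑degIn : ∀ A B → eBetween H A B ≡ ∑[ i < n ] (𝟙 (lookup A i) * degIn B i)
    eBetween≡∑degIn A B =
      trans (listSum-allFin (λ i → count (λ j → lookup A i ∧ lookup B j ∧ adj H i j)))
            (sum-cong-≗ (λ i → count-∧ˡ (lookup A i) (λ j → lookup B j ∧ adj H i j)))

  module _ {n : ℕ} (H : Graph n) (A : Subset n) (δ : ℕ) where

    atMinDeg : Fin n → Bool
    atMinDeg i = does (deg H i ℕ.≟ δ)

    chargedDeg : ℕ
    chargedDeg = ∑[ i < n ] (𝟙 (lookup A i ∧ atMinDeg i) * degIn H A i)

    eIn≤2chargedDeg : Saturated H A δ → eIn H A ≤ 2 * chargedDeg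
    eIn≤2chargedDeg saturated = begin
      eIn H A
        ≡⟨ listSum-allFin (λ i → count (λ j → (toℕ i ℕ.<ᵇ toℕ j) ∧ E i j)) ⟩
      ∑[ i < n ] count (λ j → (toℕ i ℕ.<ᵇ toℕ j) ∧ E i j)
        ≤⟨ ∑-mono-≤ (λ i → count-mono {P = λ j → (toℕ i ℕ.<ᵇ toℕ j) ∧ E i j} {Q = E i}
                                        (λ j → ∧-trueʳ (toℕ i ℕ.<ᵇ toℕ j))) ⟩
      ∑[ i < n ] count (E i)
        ≡⟨ sum-cong-≗ (λ i → count≡∑ (E i)) ⟩
      ∑[ i < n ] ∑[ j < n ] 𝟙 (E i j)
        ≤⟨ ∑-mono-≤ (λ i → ∑-mono-≤ (λ j → pair-charge i j)) ⟩
      ∑[ i < n ] ∑[ j < n ] (F i j + F j i)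
        ≡⟨ sum-cong-≗ (λ i → ∑-distrib-+ (F i) (λ j → F j i)) ⟩
      ∑[ i < n ] (∑[ j < n ] F i j + ∑[ j < n ] F j i)
        ≡⟨ ∑-distrib-+ (λ i → ∑[ j < n ] F i j) (λ i → ∑[ j < n ] F j i) ⟩
      ∑[ i < n ] ∑[ j < n ] F i j + ∑[ i < n ] ∑[ j < n ] F j i
        ≡⟨ cong (∑[ i < n ] ∑[ j < n ] F i j +_) (∑-comm (λ i j → F j i)) ⟩
      ∑[ i < n ] ∑[ j < n ] F i j + ∑[ j < n ] ∑[ i < n ] F j i
        ≡⟨ cong₂ _+_ ∑∑F≡chargedDeg ∑∑F≡chargedDeg ⟩
      chargedDeg + chargedDeg
        ≡⟨ cong (chargedDeg +_) (+-identityʳ chargedDeg) ⟨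
      2 * chargedDeg ∎
      where
      open ≤-Reasoning
      E : Fin n → Fin n → Bool
      E i j = lookup A i ∧ lookup A j ∧ adj H i j
      F : Fin n → Fin n → ℕ
      F i j = 𝟙 ((lookup A i ∧ atMinDeg i) ∧ lookup A j ∧ adj H i j)
      pair-charge : ∀ i j → 𝟙 (E i j) ≤ F i j + F j i
      pair-charge i j rewrite Graph.sym H j i =
        charge (lookup A i) (lookup A j) (adj H i j) (atMinDeg i) (atMinDeg j) λ i∈A j∈A ij∈H →
          Sum.map (dec-true (deg H i ℕ.≟ δ)) (dec-true (deg H j ℕ.≟ δ)) (saturated i j i∈A j∈A ij∈H)
      ∑∑F≡chargedDeg : ∑[ i < n ] ∑[ j < n ] F i j ≡ chargedDeg
      ∑∑F≡chargedDeg = sum-cong-≗ λ i →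
        trans (≡.sym (count≡∑ (λ j → (lookup A i ∧ atMinDeg i) ∧ lookup A j ∧ adj H i j)))
              (count-∧ˡ (lookup A i ∧ atMinDeg i) (λ j → lookup A j ∧ adj H i j))

    chargedDeg+eBetween≤ : ∀ {B} → Disjoint A B → chargedDeg + eBetween H A B ≤ (δ ⊔ ∣ B ∣) * ∣ A ∣
    chargedDeg+eBetween≤ {B} A∩B≡∅ = begin
      chargedDeg + eBetween H A B
        ≡⟨ cong (chargedDeg +_) (eBetween≡∑degIn H A B) ⟩
      chargedDeg + ∑[ i < n ] (𝟙 (lookup A i) * degIn H B i)
        ≡⟨ ∑-distrib-+ (λ i → 𝟙 (lookup A i ∧ atMinDeg i) * degIn H A i)
                       (λ i → 𝟙 (lookup A i) * degIn H B i) ⟨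
      ∑[ i < n ] (𝟙 (lookup A i ∧ atMinDeg i) * degIn H A i + 𝟙 (lookup A i) * degIn H B i)
        ≤⟨ ∑-mono-≤ vertex-bound ⟩
      ∑[ i < n ] ((δ ⊔ ∣ B ∣) * 𝟙 (lookup A i))
        ≡⟨ *-distribˡ-sum (δ ⊔ ∣ B ∣) (𝟙 ∘ lookup A) ⟨
      (δ ⊔ ∣ B ∣) * ∑[ i < n ] 𝟙 (lookup A i)
        ≡⟨ cong ((δ ⊔ ∣ B ∣) *_) (trans (≡.sym (count≡∑ (lookup A))) (≡.sym (∣p∣≡count A))) ⟩
      (δ ⊔ ∣ B ∣) * ∣ A ∣ ∎
      where
      open ≤-Reasoning
      vertex-bound : ∀ i → 𝟙 (lookup A i ∧ atMinDeg i) * degIn H A i + 𝟙 (lookup A i) * degIn H B i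
                           ≤ (δ ⊔ ∣ B ∣) * 𝟙 (lookup A i)
      vertex-bound i = byCases (lookup A i) (deg H i ℕ.≟ δ)
        where
        byCases : ∀ a (d : Dec (deg H i ≡ δ)) →
                  𝟙 (a ∧ does d) * degIn H A i + 𝟙 a * degIn H B i ≤ (δ ⊔ ∣ B ∣) * 𝟙 a
        byCases false _ = z≤n
        byCases true (yes dᵢ≡δ) =
          subst₂ _≤_ (cong₂ _+_ (≡.sym (*-identityˡ (degIn H A i))) (≡.sym (*-identityˡ (degIn H B i))))
                     (≡.sym (*-identityʳ (δ ⊔ ∣ B ∣)))
          (≤-trans (degIn-disjoint H {A} {B} A∩B≡∅ i) (≤-trans (≤-reflexive dᵢ≡δ) (m≤m⊔n δ ∣ B ∣)))
        byCases true (no _) =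
          subst₂ _≤_ (≡.sym (*-identityˡ (degIn H B i))) (≡.sym (*-identityʳ (δ ⊔ ∣ B ∣)))
          (≤-trans (degIn≤∣X∣ H B i) (m≤n⊔m δ ∣ B ∣))

    eIn+2eBetween≤ : ∀ {B} → Disjoint A B → Saturated H A δ →
                     eIn H A + 2 * eBetween H A B ≤ 2 * ((δ ⊔ ∣ B ∣) * ∣ A ∣)
    eIn+2eBetween≤ {B} A∩B≡∅ saturated = begin
      eIn H A + 2 * eBetween H A B
        ≤⟨ +-monoˡ-≤ (2 * eBetween H A B) (eIn≤2chargedDeg saturated) ⟩
      2 * chargedDeg + 2 * eBetween H A B
        ≡⟨ *-distribˡ-+ 2 chargedDeg (eBetween H A B) ⟨
      2 * (chargedDeg + eBetween H A B)
        ≤⟨ *-monoʳ-≤ 2 (chargedDeg+eBetween≤ {B} A∩B≡∅) ⟩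
      2 * ((δ ⊔ ∣ B ∣) * ∣ A ∣) ∎
      where open ≤-Reasoning

  ∧∧-cong : ∀ x y {e₁ e₂} → (x ≡ true → y ≡ true → e₁ ≡ e₂) → x ∧ y ∧ e₁ ≡ x ∧ y ∧ e₂
  ∧∧-cong false _     _  = refl
  ∧∧-cong true  false _  = refl
  ∧∧-cong true  true  eq = eq refl refl

  module _ {n : ℕ} {G G₁ : Graph n} where

    eBetween-cong : ∀ A B → (∀ i j → lookup A i ≡ true → lookup B j ≡ true → adj G₁ i j ≡ adj G i j) →
                    eBetween G₁ A B ≡ eBetween G A B
    eBetween-cong A B agree = cong listSum (map-cong (λ i →
      count-cong λ j → ∧∧-cong (lookup A i) (lookup B j) (agree i j)) (allFin n))

    eIn-cong : ∀ X → (∀ i j → lookup X i ≡ true → lookup X j ≡ true → adj G₁ i j ≡ adj G i j) →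
               eIn G₁ X ≡ eIn G X
    eIn-cong X agree = cong listSum (map-cong (λ i → count-cong λ j →
      cong ((toℕ i ℕ.<ᵇ toℕ j) ∧_) (∧∧-cong (lookup X i) (lookup X j) (agree i j))) (allFin n))

  Disjoint⇒∉ : ∀ {n} {A B : Subset n} → Disjoint A B → ∀ {j} → lookup B j ≡ true → lookup A j ≡ false
  Disjoint⇒∉ {A = A} A∩B≡∅ {j} j∈B with lookup A j in j∈?A
  ... | true  = ⊥-elim (A∩B≡∅ j (j∈?A , j∈B))
  ... | false = refl

  module _ {n : ℕ} {G G₁ : Graph n} (A B : Subset n) (A∩B≡∅ : Disjoint A B)
           (agrees : AgreeOutside A G₁ G) where

    eBetween-unchanged : eBetween G₁ A B ≡ eBetween G A B
    eBetween-unchanged = eBetween-cong {G = G} {G₁} A B λ i j _ j∈B →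
      agrees i j (inj₂ (Disjoint⇒∉ {A = A} {B} A∩B≡∅ j∈B))

    eIn-unchanged : eIn G₁ B ≡ eIn G B
    eIn-unchanged = eIn-cong {G = G} {G₁} B λ i j i∈B _ →
      agrees i j (inj₁ (Disjoint⇒∉ {A = A} {B} A∩B≡∅ i∈B))

open Combinatorial

open import Data.Fin.Subset using (Subset; ∣_∣)
open import Data.Fin.Subset.Properties using (∣p∣≤n)
open import Data.Integer as ℤ using (+_; +≤+)
import Data.Integer.Properties as ℤ
open import Data.Nat as ℕ using (ℕ; zero; suc)
import Data.Nat.Coprimality as Coprime
import Data.Nat.Properties as ℕ
open import Data.Product using (_×_; _,_; Σ; ∃; proj₁)
open import Data.Rational hiding (truncate; ∣_∣)
open import Data.Rational.Properties
open import Data.Rational.Solver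
import Data.Rational.Unnormalised as ℚᵘ
import Data.Rational.Unnormalised.Properties as ℚᵘ
open import Data.Sum using (inj₁; inj₂)
open import Function using (id)
open import Relation.Binary.PropositionalEquality as ≡ hiding (sym; [_])

open +-*-Solver

[k]≡mkℚ : ∀ k → [ k ] ≡ mkℚ (+ k) 0 (Coprime.sym (Coprime.1-coprimeTo k))
[k]≡mkℚ k = normalize-coprime _

[]-homo-+ : ∀ x y → [ x ℕ.+ y ] ≡ [ x ] + [ y ]
[]-homo-+ x y rewrite [k]≡mkℚ x | [k]≡mkℚ y = cong (_/ 1) (begin
  + (x ℕ.+ y)                     ≡⟨ ℤ.pos-+ x y ⟩
  + x ℤ.+ + y                     ≡⟨ cong₂ ℤ._+_ (ℤ.*-identityʳ (+ x)) (ℤ.*-identityʳ (+ y)) ⟨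
  + x ℤ.* + 1 ℤ.+ + y ℤ.* + 1     ∎)
  where open ≡-Reasoning

[]-homo-* : ∀ x y → [ x ℕ.* y ] ≡ [ x ] * [ y ]
[]-homo-* x y rewrite [k]≡mkℚ x | [k]≡mkℚ y = cong (_/ 1) (ℤ.pos-* x y)

[]-mono-≤ : ∀ {x y} → x ℕ.≤ y → [ x ] ≤ [ y ]
[]-mono-≤ {x} {y} x≤y rewrite [k]≡mkℚ x | [k]≡mkℚ y =
  *≤* (subst₂ ℤ._≤_ (≡.sym (ℤ.*-identityʳ (+ x))) (≡.sym (ℤ.*-identityʳ (+ y))) (+≤+ x≤y))

0≤[] : ∀ x → 0ℚ ≤ [ x ]
0≤[] x = []-mono-≤ {0} {x} ℕ.z≤n

[⊔]≤ : ∀ x y {r} → [ x ] ≤ r → [ y ] ≤ r → [ x ℕ.⊔ y ] ≤ r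
[⊔]≤ x y x≤r y≤r with ℕ.⊔-sel x y
... | inj₁ x⊔y≡x rewrite x⊔y≡x = x≤r
... | inj₂ x⊔y≡y rewrite x⊔y≡y = y≤r

[m/n]*[n]≡[m] : ∀ m n .{{_ : ℕ.NonZero n}} → ((+ m) / n) * [ n ] ≡ [ m ]
[m/n]*[n]≡[m] m zero {{()}}
[m/n]*[n]≡[m] m (suc n) = toℚᵘ-injective (ℚᵘ.≃-trans (toℚᵘ-homo-* ((+ m) / suc n) [ suc n ])
  (ℚᵘ.≃-trans (ℚᵘ.*-cong (toℚᵘ-fromℚᵘ (ℚᵘ.mkℚᵘ (+ m) n)) (toℚᵘ-fromℚᵘ (ℚᵘ.mkℚᵘ (+ suc n) 0)))
    (ℚᵘ.≃-trans (ℚᵘ.*≡* cross) (ℚᵘ.≃-sym (toℚᵘ-fromℚᵘ (ℚᵘ.mkℚᵘ (+ m) 0))))))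
  where
  cross : (+ m ℤ.* + suc n) ℤ.* + 1 ≡ + m ℤ.* + (suc n ℕ.* 1)
  cross rewrite ℤ.*-identityʳ (+ m ℤ.* + suc n) | ℕ.*-identityʳ (suc n) = refl

module _ {p q : ℚ} where

  0≤* : 0ℚ ≤ p → 0ℚ ≤ q → 0ℚ ≤ p * q
  0≤* 0≤p 0≤q = nonNegative⁻¹ _ {{nonNeg*nonNeg⇒nonNeg p {{nonNegative 0≤p}} q {{nonNegative 0≤q}}}}

  0<* : 0ℚ < p → 0ℚ < q → 0ℚ < p * q
  0<* 0<p 0<q = positive⁻¹ _ {{pos*pos⇒pos p {{positive 0<p}} q {{positive 0<q}}}}

  0≤+ : 0ℚ ≤ p → 0ℚ ≤ q → 0ℚ ≤ p + q
  0≤+ 0≤p 0≤q = nonNegative⁻¹ _ {{nonNeg+nonNeg⇒nonNeg p {{nonNegative 0≤p}} q {{nonNegative 0≤q}}}}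

  0<+ : 0ℚ < p → 0ℚ ≤ q → 0ℚ < p + q
  0<+ 0<p 0≤q = positive⁻¹ _ {{pos+nonNeg⇒pos p {{positive 0<p}} q {{nonNegative 0≤q}}}}

  p≤q⇒0≤q-p : p ≤ q → 0ℚ ≤ q - p
  p≤q⇒0≤q-p p≤q = ≤-trans (≤-reflexive (≡.sym (+-inverseʳ p))) (+-monoˡ-≤ (- p) p≤q)

  p<q⇒0<q-p : p < q → 0ℚ < q - p
  p<q⇒0<q-p p<q = ≤-<-trans (≤-reflexive (≡.sym (+-inverseʳ p))) (+-monoˡ-< (- p) p<q)

  0≤q-p⇒p≤q : 0ℚ ≤ q - p → p ≤ q
  0≤q-p⇒p≤q 0≤q-p = begin
    p              ≡⟨ +-identityˡ p ⟨
    0ℚ + p         ≤⟨ +-monoˡ-≤ p 0≤q-p ⟩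
    q - p + p      ≡⟨ solve 2 (λ p q → q :- p :+ p := q) refl p q ⟩
    q              ∎
    where open ≤-Reasoning

  0<q-p⇒p<q : 0ℚ < q - p → p < q
  0<q-p⇒p<q 0<q-p = begin-strict
    p              ≡⟨ +-identityˡ p ⟨
    0ℚ + p         <⟨ +-monoˡ-< p 0<q-p ⟩
    q - p + p      ≡⟨ solve 2 (λ p q → q :- p :+ p := q) refl p q ⟩
    q              ∎
    where open ≤-Reasoning

square-≤⇒≤ : ∀ {x y} → 0ℚ ≤ y → x * x ≤ y * y → x ≤ y
square-≤⇒≤ {x} {y} 0≤y x²≤y² = ≮⇒≥ λ y<x →
  let instance
        _ = nonNegative 0≤y
        _ = positive (≤-<-trans 0≤y y<x)
  in <-irrefl refl (begin-strict
    y * y  ≤⟨ *-monoˡ-≤-nonNeg y (<⇒≤ y<x) ⟩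
    y * x  <⟨ *-monoˡ-<-pos x y<x ⟩
    x * x  ≤⟨ x²≤y² ⟩
    y * y  ∎)
  where open ≤-Reasoning

√≤⇒≤ : ∀ {x q y} → x * x ≤ q → q √≤ y → x ≤ y
√≤⇒≤ x²≤q (0≤y , q≤y²) = square-≤⇒≤ 0≤y (≤-trans x²≤q q≤y²)

≤√⇒≤ : ∀ {x q y} → x ≤√ q → q ≤ y * y → 0ℚ ≤ y → x ≤ y
≤√⇒≤ (inj₁ x≤0)  q≤y² 0≤y = ≤-trans x≤0 0≤y
≤√⇒≤ (inj₂ x²≤q) q≤y² 0≤y = square-≤⇒≤ 0≤y (≤-trans x²≤q q≤y²)

-- The estimates below prove p ≤ q by writing q − p as a sum of products of quantities known to be
-- nonnegative; the ring solver checks the identity.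
δ≤b+ηN : ∀ {N b d η α} → 0ℚ ≤ N → 0ℚ ≤ α → α ≤ ½ → α * N ≡ d - ½ * N →
         (½ * α * (N * N)) √≤ (b - (½ - η) * N) → d ≤ b + η * N
δ≤b+ηN {N} {b} {d} {η} {α} 0≤N 0≤α α≤½ αN≡d-½N E2-lower = begin
  d                          ≡⟨ solve 2 (λ d N → d := (d :- con ½ :* N) :+ con ½ :* N) refl d N ⟩
  (d - ½ * N) + ½ * N        ≡⟨ cong (_+ ½ * N) αN≡d-½N ⟨
  α * N + ½ * N              ≤⟨ +-monoˡ-≤ (½ * N) (√≤⇒≤ {α * N} [αN]²≤½αN² E2-lower) ⟩
  (b - (½ - η) * N) + ½ * N  ≡⟨ solve 3 (λ b η N → (b :- (con ½ :- η) :* N) :+ con ½ :* N := b :+ η :* N)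
                                        refl b η N ⟩
  b + η * N                  ∎
  where
  open ≤-Reasoning
  [αN]²≤½αN² : (α * N) * (α * N) ≤ ½ * α * (N * N)
  [αN]²≤½αN² = 0≤q-p⇒p≤q (subst (0ℚ ≤_)
    (solve 2 (λ α N → α :* (con ½ :- α) :* (N :* N) := con ½ :* α :* (N :* N) :- (α :* N) :* (α :* N)) refl α N)
    (0≤* (0≤* 0≤α (p≤q⇒0≤q-p α≤½)) (0≤* 0≤N 0≤N)))

½-αN≤8a : ∀ {N a η α} → 0ℚ ≤ N → 0ℚ ≤ α → α ≤ ½ → η ≤ (½ - α) * (+ 1 / 64) →
          ((½ - η) * N - a) ≤√ (½ * α * (N * N)) → (½ - α) * N ≤ a * [ 8 ]
½-αN≤8a {N} {a} {η} {α} 0≤N 0≤α α≤½ η≤ E1-lower = 0≤q-p⇒p≤q (subst (0ℚ ≤_)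
  (solve 4 (λ N a η α →
     con [ 8 ] :* (z′ N α :- ((con ½ :- η) :* N :- a)) :+ con [ 8 ] :* N :* ((con ½ :- α) :* con (+ 1 / 64) :- η)
       :+ con (+ 7 / 8) :* (con ½ :- α) :* N
     := a :* con [ 8 ] :- (con ½ :- α) :* N) refl N a η α)
  (0≤+ (0≤+ (0≤* (0≤[] 8) (p≤q⇒0≤q-p Y≤z)) (0≤* (0≤* (0≤[] 8) 0≤N) (p≤q⇒0≤q-p η≤)))
       (0≤* (0≤* (nonNegative⁻¹ (+ 7 / 8)) (p≤q⇒0≤q-p α≤½)) 0≤N)))
  where
  z′ : ∀ {k} → Polynomial k → Polynomial k → Polynomial k
  z′ N α = (con ½ :- (con ½ :- α) :* con (+ 1 / 4)) :* N
  z : ℚ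
  z = (½ - (½ - α) * (+ 1 / 4)) * N
  ½αN²≤z² : ½ * α * (N * N) ≤ z * z
  ½αN²≤z² = 0≤q-p⇒p≤q (subst (0ℚ ≤_)
    (solve 2 (λ N α → (N :* N) :* ((con ½ :- α) :* ((con ½ :- α) :+ con [ 4 ])) :* con (+ 1 / 16)
                      := z′ N α :* z′ N α :- con ½ :* α :* (N :* N)) refl N α)
    (0≤* (0≤* (0≤* 0≤N 0≤N) (0≤* (p≤q⇒0≤q-p α≤½) (0≤+ (p≤q⇒0≤q-p α≤½) (0≤[] 4)))) (nonNegative⁻¹ (+ 1 / 16))))
  0≤z : 0ℚ ≤ z
  0≤z = subst (0ℚ ≤_) (solve 2 (λ N α → (con (+ 3 / 8) :+ α :* con (+ 1 / 4)) :* N := z′ N α) refl N α)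
    (0≤* (0≤+ (nonNegative⁻¹ (+ 3 / 8)) (0≤* 0≤α (nonNegative⁻¹ (+ 1 / 4)))) 0≤N)
  Y≤z : (½ - η) * N - a ≤ z
  Y≤z = ≤√⇒≤ E1-lower ½αN²≤z² 0≤z

8N≤Ca : ∀ {C t N a} (0<C : 0ℚ < C) → 0ℚ ≤ N → (1/ C) {{>-nonZero 0<C}} ≤ t * (+ 1 / 64) →
        t * N ≤ a * [ 8 ] → N * [ 8 ] ≤ C * a
8N≤Ca {C} {t} {N} {a} 0<C 0≤N C⁻¹≤t/64 tN≤8a = 0≤q-p⇒p≤q (subst (0ℚ ≤_) certificate
  (0≤+ (0≤* (0≤* (<⇒≤ 0<C) (p≤q⇒0≤q-p tN≤8a)) (nonNegative⁻¹ (+ 1 / 8)))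
       (0≤* (0≤* (0≤* 0≤N (0≤[] 8)) (<⇒≤ 0<C)) (p≤q⇒0≤q-p C⁻¹≤t/64))))
  where
  instance _ = >-nonZero 0<C
  certificate : C * (a * [ 8 ] - t * N) * (+ 1 / 8) + N * [ 8 ] * C * (t * (+ 1 / 64) - 1/ C) ≡ C * a - N * [ 8 ]
  certificate = begin
    C * (a * [ 8 ] - t * N) * (+ 1 / 8) + N * [ 8 ] * C * (t * (+ 1 / 64) - 1/ C)
      ≡⟨ solve 5 (λ C t N a C⁻¹ →
           C :* (a :* con [ 8 ] :- t :* N) :* con (+ 1 / 8) :+ N :* con [ 8 ] :* C :* (t :* con (+ 1 / 64) :- C⁻¹)
           := C :* a :- N :* con [ 8 ] :* (C :* C⁻¹)) refl C t N a (1/ C) ⟩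
    C * a - N * [ 8 ] * (C * 1/ C)
      ≡⟨ cong (λ c → C * a - N * [ 8 ] * c) (*-inverseʳ C) ⟩
    C * a - N * [ 8 ] * 1ℚ
      ≡⟨ cong (λ x → C * a - x) (*-identityʳ (N * [ 8 ])) ⟩
    C * a - N * [ 8 ] ∎
    where open ≡-Reasoning

eIn<Cηa² : ∀ {η C} (N a b m e E : ℕ) → 0ℚ < η → e ℕ.+ 2 ℕ.* E ℕ.≤ 2 ℕ.* (m ℕ.* a) →
           (1ℚ - η) * [ a ] * [ b ] < [ E ] → [ m ] ≤ [ b ] + η * [ N ] → b ℕ.≤ N →
           [ N ] * [ 8 ] ≤ C * [ a ] → [ e ] < C * η * ([ a ] * [ a ])
eIn<Cηa² {η} {C} N a b m e E 0<η counted E3 m≤b+ηN b≤N 8N≤Ca = 0<q-p⇒p<q (subst (0ℚ <_)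
  (solve 8 (λ N a b m e E η C →
     con [ 2 ] :* (E :- (con 1ℚ :- η) :* a :* b) :+ (con [ 2 ] :* (m :* a) :- (e :+ con [ 2 ] :* E))
       :+ con [ 2 ] :* a :* ((b :+ η :* N) :- m) :+ con [ 2 ] :* η :* a :* (N :- b)
       :+ η :* a :* (C :* a :- N :* con [ 8 ]) :+ con [ 4 ] :* η :* a :* N
     := C :* η :* (a :* a) :- e) refl [ N ] [ a ] [ b ] [ m ] [ e ] [ E ] η C)
  (0<+ (0<+ (0<+ (0<+ (0<+ (0<* (positive⁻¹ [ 2 ]) (p<q⇒0<q-p E3))
                           (p≤q⇒0≤q-p counted′))
                      (0≤* (0≤* (0≤[] 2) (0≤[] a)) (p≤q⇒0≤q-p m≤b+ηN)))
                 (0≤* (0≤* (0≤* (0≤[] 2) 0≤η) (0≤[] a)) (p≤q⇒0≤q-p ([]-mono-≤ b≤N))))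
            (0≤* (0≤* 0≤η (0≤[] a)) (p≤q⇒0≤q-p 8N≤Ca)))
       (0≤* (0≤* (0≤* (0≤[] 4) 0≤η) (0≤[] a)) (0≤[] N))))
  where
  0≤η = <⇒≤ 0<η
  counted′ : [ e ] + [ 2 ] * [ E ] ≤ [ 2 ] * ([ m ] * [ a ])
  counted′ = subst₂ _≤_ (trans ([]-homo-+ e (2 ℕ.* E)) (cong (λ x → [ e ] + x) ([]-homo-* 2 E)))
                        (trans ([]-homo-* 2 (m ℕ.* a)) (cong ([ 2 ] *_) ([]-homo-* m a)))
                        ([]-mono-≤ counted)

sparsify : ∀ (n : ℕ) .{{_ : ℕ.NonZero n}} (η C : ℚ) (η>0 : 0ℚ < η) (C>0 : 0ℚ < C)
  (G : Graph n) (δ : ℕ) → IsMinDeg G δ →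
  let α = ((+ δ) / n) - ½ in
  (0ℚ ≤ α) → (0ℚ < ½ - α) →
  (η ≤ (1/ C) {{>-nonZero C>0}}) →
  ((1/ C) {{>-nonZero C>0}} ≤ (½ - α) * (+ 1 / 64)) →
  (A B : Subset n) → Extremal-E1-E4 η α G A B →
  Σ (Graph n) λ G₁ →
    SpanningSubgraph G₁ G ×
    Extremal-E1-E4 η α G₁ A B ×
    IsMinDeg G₁ δ ×
    ([ eIn G₁ A ] < C * η * ([ ∣ A ∣ ] * [ ∣ A ∣ ]))
sparsify n η C 0<η 0<C G δ minDeg 0≤α 0<½-α η≤C⁻¹ C⁻¹≤ A B (A∩B≡∅ , e₁ , e₂ , e₃ , e₄) =
  G₁ , spanning , (A∩B≡∅ , e₁ , e₂ , e₃′ , e₄′) , SaturatedSubgraph.minDeg S ,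
  eIn<Cηa² {η} {C} n ∣ A ∣ ∣ B ∣ (δ ℕ.⊔ ∣ B ∣) (eIn G₁ A) (eBetween G₁ A B) 0<η
           (eIn+2eBetween≤ G₁ A δ {B} A∩B≡∅ saturated) e₃′ δ⊔∣B∣≤∣B∣+ηN (∣p∣≤n B) 8N≤C∣A∣
  where
  S = saturatedSubgraph G A minDeg
  open SaturatedSubgraph S using (spanning; agrees; saturated) renaming (graph to G₁)
  N = [ n ]
  α = ((+ δ) / n) - ½
  e₃′ : E3 η α G₁ A B
  e₃′ = subst (λ e → (1ℚ - η) * [ ∣ A ∣ ] * [ ∣ B ∣ ] < [ e ])
              (≡.sym (eBetween-unchanged {G = G} {G₁} A B A∩B≡∅ agrees)) e₃
  e₄′ : E4 η α G₁ A B
  e₄′ = subst (λ e → ([ 2 ℕ.* e ] - ((α ₊) + η) * N * [ ∣ B ∣ ])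
                     <√ (½ * (α ₊) * ((N * [ ∣ B ∣ ]) * (N * [ ∣ B ∣ ]))))
              (≡.sym (eIn-unchanged {G = G} {G₁} A B A∩B≡∅ agrees)) e₄
  α₊≡α : α ₊ ≡ α
  α₊≡α = p≥q⇒p⊔q≡p 0≤α
  α≤½ : α ≤ ½
  α≤½ = 0≤q-p⇒p≤q (<⇒≤ 0<½-α)
  αN≡δ-½N : α * N ≡ [ δ ] - ½ * N
  αN≡δ-½N = trans (solve 2 (λ r N → (r :- con ½) :* N := r :* N :- con ½ :* N) refl ((+ δ) / n) N)
                  (cong (_- ½ * N) ([m/n]*[n]≡[m] δ n))
  δ≤∣B∣+ηN : [ δ ] ≤ [ ∣ B ∣ ] + η * N
  δ≤∣B∣+ηN = δ≤b+ηN {b = [ ∣ B ∣ ]} {η = η} (0≤[] n) 0≤α α≤½ αN≡δ-½N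
    (subst (λ x → (½ * x * (N * N)) √≤ ([ ∣ B ∣ ] - (½ - η) * N)) α₊≡α (proj₁ e₂))
  ∣B∣≤∣B∣+ηN : [ ∣ B ∣ ] ≤ [ ∣ B ∣ ] + η * N
  ∣B∣≤∣B∣+ηN = 0≤q-p⇒p≤q (subst (0ℚ ≤_) (solve 2 (λ b x → x := (b :+ x) :- b) refl [ ∣ B ∣ ] (η * N))
                                        (0≤* (<⇒≤ 0<η) (0≤[] n)))
  δ⊔∣B∣≤∣B∣+ηN : [ δ ℕ.⊔ ∣ B ∣ ] ≤ [ ∣ B ∣ ] + η * N
  δ⊔∣B∣≤∣B∣+ηN = [⊔]≤ δ ∣ B ∣ δ≤∣B∣+ηN ∣B∣≤∣B∣+ηN
  ½-αN≤8∣A∣ : (½ - α) * N ≤ [ ∣ A ∣ ] * [ 8 ]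
  ½-αN≤8∣A∣ = ½-αN≤8a {a = [ ∣ A ∣ ]} {η = η} (0≤[] n) 0≤α α≤½ (≤-trans η≤C⁻¹ C⁻¹≤)
    (subst (λ x → ((½ - η) * N - [ ∣ A ∣ ]) ≤√ (½ * x * (N * N))) α₊≡α (proj₁ e₁))
  8N≤C∣A∣ : N * [ 8 ] ≤ C * [ ∣ A ∣ ]
  8N≤C∣A∣ = 8N≤Ca {t = ½ - α} {a = [ ∣ A ∣ ]} 0<C (0≤[] n) C⁻¹≤ ½-αN≤8∣A∣

lemma4p1 : ∃ λ (f₁ : ℚ → ℚ) → ∃ λ (f₂ : ℚ → ℚ) → ∃ λ (f₃ : ℚ → ℚ) →
    (∀ x y → x ≤ y → f₁ x ≤ f₁ y) × (∀ x y → x ≤ y → f₂ x ≤ f₂ y) × (∀ x y → x ≤ y → f₃ x ≤ f₃ y) ×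
    (∀ x → 0ℚ < x → 0ℚ < f₁ x) × (∀ x → 0ℚ < x → 0ℚ < f₂ x) × (∀ x → 0ℚ < x → 0ℚ < f₃ x) ×
    (∀ (n : ℕ) .{{_ : ℕ.NonZero n}} (η C : ℚ) (η>0 : 0ℚ < η) (C>0 : 0ℚ < C)
       (G : Graph n) (δ : ℕ) → IsMinDeg G δ →
       let α = ((+ δ) / n) - ½ in
       (0ℚ ≤ α) → (0ℚ < ½ - α) →
       ((+ 1) / n ≤ f₁ η) →
       (η ≤ f₂ ((1/ C) {{>-nonZero C>0}})) →
       ((1/ C) {{>-nonZero C>0}} ≤ f₃ (½ - α)) →
       (A B : Subset n) → Extremal-E1-E4 η α G A B →
       Σ (Graph n) λ G₁ →
         SpanningSubgraph G₁ G ×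
         Extremal-E1-E4 η α G₁ A B ×
         IsMinDeg G₁ δ ×
         ([ eIn G₁ A ] < C * η * ([ ∣ A ∣ ] * [ ∣ A ∣ ])))
lemma4p1 =
  (λ _ → 1ℚ) , id , (_* (+ 1 / 64)) ,
  (λ _ _ _ → ≤-refl) , (λ _ _ → id) , (λ _ _ → *-monoʳ-≤-nonNeg (+ 1 / 64)) ,
  (λ _ _ → positive⁻¹ 1ℚ) , (λ _ → id) , (λ _ 0<x → 0<* 0<x (positive⁻¹ (+ 1 / 64))) ,
  λ n η C 0<η 0<C G δ minDeg 0≤α 0<½-α _ → sparsify n η C 0<η 0<C G δ minDeg 0≤α 0<½-α
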